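{- Let $k\ge1$, $d\ge1$ be integers, $n=dk$, let $p\in\mathbb Z$ and $c\in\{ -1,0,1\}$ with $k=dp+c$, let $a_1,\dots,a_k$ be an enumeration of $[k]$, and let $\mathcal L_s$ ($1\le s\le k-p+1$) be the collections constructed from these data as in the context. If $I,J\in\mathcal L_s$ for the same $s$, then $I$ and $J$ are noncrossing.
   Context: Cyclically ordered sets: a finite set $X$ with a bijection $S_X$ (successor) whose powers act transitively; $[n]=\{1,\dots,n\}$ has successor $i\mapsto i+1$ ($i<n$), $n\mapsto1$. A nonempty $Q\subseteq X$ inherits the successor $S_Q(q)=S_X^m(q)$, $m>0$ least with $S_X^m(q)\in Q$. For $a,b\in X$ the interval $[a,b]_X$ is the smallest subset containing $a,b$ with $S_X([a,b]_X\setminus\{b\})\subseteq[a,b]_X$. Subsets $I,J\subseteq[n]$ are crossing if there exist distinct $a,b,c,d$ occurring in this cyclic order around $[n]$ with $a,c\in I\setminus J$, $b,d\in J\setminus I$; otherwise noncrossing. For $a,b\in[n]$, $a\oplus_n b$ is $a+b$ reduced modulo $n$ into $[n]$, and $I\oplus_n b=\{i\oplus_n b:i\in I\}$. Construction: for $a\in[n]$ put $\overline a=(a+k\mathbb Z)\cap[n]$. For $1\le s\le k-p+1$ let $P_s=[n]\setminus\bigcup_{i=1}^{s-1}\overline{a_i}$ with induced cyclic order, and for $1\le h\le d$ let $P_{s,h}=P_s\setminus\{S^m_{\overline{a_s}}(a_s): h\le m<d\}$. For $i\in[S_{P_s}(a_s\oplus_n(n-k)),a_s]_{P_s}$ put $I(i,h)=\{i,S_{P_{s,h}}(i),\dots,S_{P_{s,h}}^{k-1}(i)\}$.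 Let $B_s=\{I(i,h): i\in[S_{P_s}(a_s\oplus_n(n-k)),a_s]_{P_s},\ 1\le h\le d,\ |I(i,h)|=k\}$ and $\mathcal L_s=\{I\oplus_n xk: I\in B_s, x\in\mathbb Z\}$. -}

module Defs where

open import Data.Bool using (Bool; true; false; if_then_else_; _∧_; _∨_; not)
open import Data.Nat using (ℕ; zero; suc; _+_; _*_; _∸_; _≤_; _<_; _<ᵇ_; _≤ᵇ_; _≡ᵇ_; _%_)
open import Data.Integer as ℤ using (ℤ; +_; _%ℕ_)
open import Data.List using (List; []; _∷_; map; upTo)
open import Data.Bool.ListAction using (any)
open import Data.List.Membership.Propositional using (_∈_)
open import Data.Product using (∃; _×_)
open import Data.Sum using (_⊎_)
open import Relation.Nullary using (¬_)
open import Relation.Binary.PropositionalEquality using (_≡_)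

-- Elements of [n] = {1,…,n} are natural numbers 1..n.
-- Subsets of [n] are given by characteristic functions ℕ → Bool.
Subset : Set
Subset = ℕ → Bool

inRange : ℕ → ℕ → Bool
inRange n x = (1 ≤ᵇ x) ∧ (x ≤ᵇ n)

sucN : ℕ → ℕ → ℕ
sucN n i = if i <ᵇ n then suc i else 1

iter : ℕ → (ℕ → ℕ) → ℕ → ℕ
iter zero    f x = x
iter (suc m) f x = f (iter m f x)

-- induced successor S_Q(q) = S^m(q), m > 0 least with S^m(q) ∈ Q,
-- searched for m = 1,…,fuel (fuel n suffices since S^n = id on [n]
-- and Q is nonempty in all uses).
seek : ℕ → Subset → ℕ → ℕ → ℕ
seek n Q zero     q = q
seek n Q (suc f)  q = if Q (sucN n q) then sucN n q else seek n Q f (sucN n q)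

indSuc : ℕ → Subset → ℕ → ℕ
indSuc n Q q = seek n Q n q

reduce : ℕ → ℤ → ℕ
reduce zero    z = 0
reduce (suc n) z = if (z %ℕ suc n) ≡ᵇ 0 then suc n else (z %ℕ suc n)

_⊕[_]_ : ℕ → ℕ → ℤ → ℕ
a ⊕[ n ] b = reduce n (+ a ℤ.+ b)

modK : ℕ → ℕ → ℕ
modK zero    x = x
modK (suc k) x = x % suc k

cls : ℕ → ℕ → ℕ → Subset
cls n k a x = inRange n x ∧ (modK k x ≡ᵇ modK k a)

oneTo : ℕ → List ℕ
oneTo m = map suc (upTo m)

rangeFrom : ℕ → ℕ → List ℕ
rangeFrom h d = map (_+ h) (upTo (d ∸ h))

P : ℕ → ℕ → (ℕ → ℕ) → ℕ → Subset
P n k a s x = inRange n x ∧ not (any (λ i → cls n k (a i) x) (oneTo (s ∸ 1)))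

Psh : ℕ → ℕ → ℕ → (ℕ → ℕ) → ℕ → ℕ → Subset
Psh n k d a s h x =
  P n k a s x ∧ not (any (λ m → x ≡ᵇ iter m (indSuc n (cls n k (a s))) (a s)) (rangeFrom h d))

-- interval [x,y]_X: the smallest subset containing x, y and such that
-- S_X([x,y]_X \ {y}) ⊆ [x,y]_X  (inductive = least such set)
data Interval (S : ℕ → ℕ) (x y : ℕ) : ℕ → Set where
  left  : Interval S x y x
  right : Interval S x y y
  step  : ∀ {z} → Interval S x y z → ¬ (z ≡ y) → Interval S x y (S z)

orbit : (ℕ → ℕ) → ℕ → ℕ → List ℕ
orbit S zero    i = []
orbit S (suc m) i = i ∷ orbit S m (S i)

Iset : ℕ → ℕ → ℕ → (ℕ → ℕ) → ℕ → ℕ → ℕ → List ℕ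
Iset n k d a s i h = orbit (indSuc n (Psh n k d a s h)) k i

InIdx : ℕ → ℕ → (ℕ → ℕ) → ℕ → ℕ → Set
InIdx n k a s i =
  Interval (indSuc n (P n k a s))
           (indSuc n (P n k a s) (a s ⊕[ n ] (+ (n ∸ k))))
           (a s) i

shift : ℕ → List ℕ → ℤ → List ℕ
shift n I b = map (λ i → i ⊕[ n ] b) I

CyclicOrder : ℕ → ℕ → ℕ → ℕ → Set
CyclicOrder a b c d =
  (a < b × b < c × c < d) ⊎ (b < c × c < d × d < a) ⊎
  (c < d × d < a × a < b) ⊎ (d < a × a < b × b < c)

Crossing : List ℕ → List ℕ → Set
Crossing I J = ∃ λ a → ∃ λ b → ∃ λ c → ∃ λ d →
  CyclicOrder a b c d ×
  (a ∈ I × ¬ a ∈ J) × (c ∈ I × ¬ c ∈ J) ×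
  (b ∈ J × ¬ b ∈ I) × (d ∈ J × ¬ d ∈ I)

Noncrossing : List ℕ → List ℕ → Set
Noncrossing I J = ¬ Crossing I J

-- Measure every point of [n] by its offset from a base point t, the number of
-- successor steps from t to it. The induced successor of Q ⊆ [n] moves to the
-- next point of Q in this order, so an orbit of it is an initial segment of Q
-- seen from its starting point. Given offset(i, a_s) < k, which the index
-- interval guarantees, removing the tail {a_s + m k : h ≤ m < d} of the class
-- ā_s from P_s therefore makes I(i, h) a truncated segment: the points of P_s
-- at offset < L from i, where those of ā_s must even have offset
-- < offset(i, a_s) + h k. Translation by a multiple of k preserves P_s and ā_s,
-- both unions of residue classes modulo k, so every member of 𝓛_s is such a
-- segment for the same P_s and ā_s. Two of them cannot cross: if x ∈ B ∖ A
-- precedes c ∈ A ∖ B as seen from A's base point, x must be a point of ā_s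
-- cut off by A, so c ∉ ā_s, and c ∉ B puts c beyond B's bound L′; the four
-- alternating points then contradict the bounds of B in every cyclic position.

module Submission where

open import Defs

open import Data.Bool using (true; false; T; not; _∧_)
open import Data.Bool.Properties using (T-≡; T-∧)
open import Data.Bool.ListAction using (any)
open import Data.Empty using (⊥)
open import Data.Integer as ℤ using (ℤ; +_; -[1+_]; _%ℕ_; _/ℕ_)
import Data.Integer.Properties as ℤ
open import Data.Integer.DivMod using (a≡a%ℕn+[a/ℕn]*n; n%ℕd<d)
open import Data.Integer.Tactic.RingSolver using (solve-∀)
open import Data.List using ([]; _∷_; _++_; [_])
open import Data.List.Membership.Propositional using (_∈_; find; lose)
open import Data.List.Membership.Propositional.Properties
  using (∈-map⁺; ∈-map⁻; ∈-upTo⁺; ∈-upTo⁻; ∈-++⁺ˡ; ∈-++⁺ʳ; ∈-++⁻)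
open import Data.List.Relation.Unary.Any using (here)
open import Data.List.Relation.Unary.Any.Properties using (any⁺; any⁻)
open import Data.List.Relation.Unary.Unique.Propositional using (Unique)
open import Data.Nat
open import Data.Nat.Properties
open import Data.Nat.DivMod
open import Data.Nat.Divisibility using (_∣_; divides)
open import Data.Product using (∃; _×_; _,_; proj₁; proj₂)
open import Data.Sum using (_⊎_; inj₁; inj₂)
open import Data.Unit using (tt)
open import Function using (_∘_; _⇔_; mk⇔; Equivalence)
open import Relation.Nullary using (¬_; yes; no; contradiction)
open import Relation.Nullary.Decidable using (T?)
open import Relation.Binary.PropositionalEquality
  using (_≡_; _≢_; refl; sym; trans; cong; cong₂; subst; subst₂; module ≡-Reasoning)

T-not⇔¬T : ∀ {x} → T (not x) ⇔ (¬ T x)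
T-not⇔¬T {true}  = mk⇔ (λ ()) (λ ¬t → ¬t tt)
T-not⇔¬T {false} = mk⇔ (λ _ ()) (λ _ → tt)

m<n∸o⇒m+o<n : ∀ {m n o} → m < n ∸ o → m + o < n
m<n∸o⇒m+o<n {m} {n} {o} m<n∸o with o ≤? n
... | yes o≤n = m≤o∸n⇒m+n≤o (suc m) o≤n m<n∸o
... | no  o≰n = contradiction (subst (m <_) (m≤n⇒m∸n≡0 (<⇒≤ (≰⇒> o≰n))) m<n∸o) λ ()

module _ {n : ℕ} .{{_ : NonZero n}} where

  [m%n+o]%n≡[m+o]%n : ∀ m o → (m % n + o) % n ≡ (m + o) % n
  [m%n+o]%n≡[m+o]%n m o = begin
    (m % n + o) % n            ≡⟨ %-distribˡ-+ (m % n) o n ⟩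
    (m % n % n + o % n) % n    ≡⟨ cong (λ u → (u + o % n) % n) (m%n%n≡m%n m n) ⟩
    (m % n + o % n) % n        ≡⟨ %-distribˡ-+ m o n ⟨
    (m + o) % n                ∎
    where open ≡-Reasoning

  [m+o%n]%n≡[m+o]%n : ∀ m o → (m + o % n) % n ≡ (m + o) % n
  [m+o%n]%n≡[m+o]%n m o = begin
    (m + o % n) % n  ≡⟨ cong (_% n) (+-comm m (o % n)) ⟩
    (o % n + m) % n  ≡⟨ [m%n+o]%n≡[m+o]%n o m ⟩
    (o + m) % n      ≡⟨ cong (_% n) (+-comm o m) ⟩
    (m + o) % n      ∎
    where open ≡-Reasoning

  -- Adding n ∸ t % n undoes the addition of t.
  +-cancelˡ-% : ∀ t {u v} → u < n → v < n → (t + u) % n ≡ (t + v) % n → u ≡ v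
  +-cancelˡ-% t {u} {v} u<n v<n eq = begin
    u                              ≡⟨ undo u<n ⟨
    ((n ∸ t % n) + (t + u) % n) % n ≡⟨ cong (λ w → ((n ∸ t % n) + w) % n) eq ⟩
    ((n ∸ t % n) + (t + v) % n) % n ≡⟨ undo v<n ⟩
    v                              ∎
    where
      open ≡-Reasoning
      undo : ∀ {w} → w < n → ((n ∸ t % n) + (t + w) % n) % n ≡ w
      undo {w} w<n = begin
        ((n ∸ t % n) + (t + w) % n) % n     ≡⟨ cong (λ x → ((n ∸ t % n) + x) % n) ([m%n+o]%n≡[m+o]%n t w) ⟨
        ((n ∸ t % n) + (t % n + w) % n) % n ≡⟨ [m+o%n]%n≡[m+o]%n (n ∸ t % n) (t % n + w) ⟩
        ((n ∸ t % n) + (t % n + w)) % n     ≡⟨ cong (_% n) (+-assoc (n ∸ t % n) (t % n) w) ⟨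
        ((n ∸ t % n) + t % n + w) % n       ≡⟨ cong (λ x → (x + w) % n) (m∸n+n≡m (<⇒≤ (m%n<n t n))) ⟩
        (n + w) % n                         ≡⟨ cong (_% n) (+-comm n w) ⟩
        (w + n) % n                         ≡⟨ [m+n]%n≡m%n w n ⟩
        w % n                               ≡⟨ m<n⇒m%n≡m w<n ⟩
        w                                   ∎

  %-injectiveOn-[1,n] : ∀ {u v} → 1 ≤ u → u ≤ n → 1 ≤ v → v ≤ n → u % n ≡ v % n → u ≡ v
  %-injectiveOn-[1,n] {suc u} {suc v} _ u<n _ v<n eq = cong suc (+-cancelˡ-% 1 u<n v<n eq)

  [m+o]%n≥o⇒[m+o]%n≡m+o : ∀ {m o} → m < n → o ≤ (m + o) % n → (m + o) % n ≡ m + o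
  [m+o]%n≥o⇒[m+o]%n≡m+o {m} {o} m<n o≤ with m + o <? n
  ... | yes m+o<n = m<n⇒m%n≡m m+o<n
  ... | no m+o≮n = contradiction o≤ (<⇒≱ wrapped)
    where
      n≤m+o : n ≤ m + o
      n≤m+o = ≮⇒≥ m+o≮n
      wrapped : (m + o) % n < o
      wrapped = begin-strict
        (m + o) % n   ≡⟨ m≤n⇒[n∸m]%m≡n%m n≤m+o ⟨
        (m + o ∸ n) % n ≤⟨ m%n≤m (m + o ∸ n) n ⟩
        m + o ∸ n     <⟨ ∸-monoˡ-< (+-monoˡ-< o m<n) n≤m+o ⟩
        n + o ∸ n     ≡⟨ m+n∸m≡n n o ⟩
        o             ∎
        where open ≤-Reasoning

i≡[i+j*k]+[-j]*k : ∀ (i j k : ℤ) → i ≡ (i ℤ.+ j ℤ.* k) ℤ.+ ℤ.- j ℤ.* k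
i≡[i+j*k]+[-j]*k = solve-∀

+r≡+m+z*n⇒r≡m%n : ∀ {n} .{{_ : NonZero n}} {r m} (z : ℤ) → r < n → + r ≡ + m ℤ.+ z ℤ.* + n → r ≡ m % n
+r≡+m+z*n⇒r≡m%n {n} {r} {m} (+ z) r<n eq = begin
  r               ≡⟨ m<n⇒m%n≡m r<n ⟨
  r % n           ≡⟨ cong (_% n) (ℤ.+-injective (trans eq (cong (ℤ._+_ (+ m)) (sym (ℤ.pos-* z n))))) ⟩
  (m + z * n) % n ≡⟨ [m+kn]%n≡m%n m z n ⟩
  m % n           ∎
  where open ≡-Reasoning
+r≡+m+z*n⇒r≡m%n {n} {r} {m} -[1+ z ] r<n eq = begin
  r                   ≡⟨ m<n⇒m%n≡m r<n ⟨
  r % n               ≡⟨ [m+kn]%n≡m%n r (suc z) n ⟨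
  (r + suc z * n) % n ≡⟨ cong (_% n) (ℤ.+-injective m≡) ⟨
  m % n               ∎
  where
    open ≡-Reasoning
    m≡ : + m ≡ + (r + suc z * n)
    m≡ = begin
      + m                                        ≡⟨ i≡[i+j*k]+[-j]*k (+ m) -[1+ z ] (+ n) ⟩
      (+ m ℤ.+ -[1+ z ] ℤ.* + n) ℤ.+ + suc z ℤ.* + n ≡⟨ cong (ℤ._+ + suc z ℤ.* + n) eq ⟨
      + r ℤ.+ + suc z ℤ.* + n                     ≡⟨ cong (ℤ._+_ (+ r)) (ℤ.pos-* (suc z) n) ⟨
      + (r + suc z * n)                           ∎

[+m+i]%ℕn≡[m+i%ℕn]%n : ∀ {n} .{{_ : NonZero n}} m (i : ℤ) → (+ m ℤ.+ i) %ℕ n ≡ (m + i %ℕ n) % n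
[+m+i]%ℕn≡[m+i%ℕn]%n {n} m i = +r≡+m+z*n⇒r≡m%n (qi ℤ.- qj) (n%ℕd<d j n) (begin
  + (j %ℕ n)                                                ≡⟨ i≡[i+j*k]+[-j]*k (+ (j %ℕ n)) qj (+ n) ⟩
  (+ (j %ℕ n) ℤ.+ qj ℤ.* + n) ℤ.+ ℤ.- qj ℤ.* + n            ≡⟨ cong (λ w → w ℤ.+ ℤ.- qj ℤ.* + n) (a≡a%ℕn+[a/ℕn]*n j n) ⟨
  (+ m ℤ.+ i) ℤ.+ ℤ.- qj ℤ.* + n                            ≡⟨ cong (λ w → (+ m ℤ.+ w) ℤ.+ ℤ.- qj ℤ.* + n)
                                                                   (a≡a%ℕn+[a/ℕn]*n i n) ⟩
  (+ m ℤ.+ (+ (i %ℕ n) ℤ.+ qi ℤ.* + n)) ℤ.+ ℤ.- qj ℤ.* + n ≡⟨ regroup (+ m) (+ (i %ℕ n)) qi qj (+ n) ⟩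
  + (m + i %ℕ n) ℤ.+ (qi ℤ.- qj) ℤ.* + n                    ∎)
  where
    open ≡-Reasoning
    j qi qj : ℤ
    j  = + m ℤ.+ i
    qi = i /ℕ n
    qj = j /ℕ n
    regroup : ∀ (m e q q′ n : ℤ) →
              (m ℤ.+ (e ℤ.+ q ℤ.* n)) ℤ.+ ℤ.- q′ ℤ.* n ≡ (m ℤ.+ e) ℤ.+ (q ℤ.- q′) ℤ.* n
    regroup = solve-∀

[x*k]%ℕ[d*k]%k≡0 : ∀ {k} .{{_ : NonZero k}} (x : ℤ) d .{{_ : NonZero (d * k)}} → ((x ℤ.* + k) %ℕ (d * k)) % k ≡ 0
[x*k]%ℕ[d*k]%k≡0 {k} x d = sym (+r≡+m+z*n⇒r≡m%n (ℤ.- (x ℤ.- q ℤ.* + d)) (>-nonZero⁻¹ k) (sym (begin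
  + e ℤ.+ ℤ.- (x ℤ.- q ℤ.* + d) ℤ.* + k       ≡⟨ cancel (+ e) x q (+ d) (+ k) ⟩
  (+ e ℤ.+ q ℤ.* (+ d ℤ.* + k)) ℤ.- x ℤ.* + k ≡⟨ cong (λ w → (+ e ℤ.+ q ℤ.* w) ℤ.- x ℤ.* + k) (ℤ.pos-* d k) ⟨
  (+ e ℤ.+ q ℤ.* + (d * k)) ℤ.- x ℤ.* + k     ≡⟨ cong (ℤ._- x ℤ.* + k) (a≡a%ℕn+[a/ℕn]*n (x ℤ.* + k) (d * k)) ⟨
  x ℤ.* + k ℤ.- x ℤ.* + k                     ≡⟨ ℤ.+-inverseʳ (x ℤ.* + k) ⟩
  + 0                                         ∎)))
  where
    open ≡-Reasoning
    e : ℕ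
    e = (x ℤ.* + k) %ℕ (d * k)
    q : ℤ
    q = (x ℤ.* + k) /ℕ (d * k)
    cancel : ∀ (e x q d k : ℤ) → e ℤ.+ ℤ.- (x ℤ.- q ℤ.* d) ℤ.* k ≡ (e ℤ.+ q ℤ.* (d ℤ.* k)) ℤ.- x ℤ.* k
    cancel = solve-∀

quotient-positive : ∀ {k d} (p c : ℤ) → 2 ≤ k → (c ≡ ℤ.- (+ 1) ⊎ c ≡ + 0 ⊎ c ≡ + 1) →
                    + k ≡ + d ℤ.* p ℤ.+ c → ¬ p ℤ.≤ + 0
quotient-positive {k} {d} p c 2≤k c∈ eq p≤0 = contradiction (≤-trans 2≤k (ℤ.drop‿+≤+ k≤1)) λ { (s≤s ()) }
  where
    c≤1 : ∀ {c} → (c ≡ ℤ.- (+ 1) ⊎ c ≡ + 0 ⊎ c ≡ + 1) → c ℤ.≤ + 1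
    c≤1 (inj₁ refl)        = ℤ.-≤+
    c≤1 (inj₂ (inj₁ refl)) = ℤ.+≤+ z≤n
    c≤1 (inj₂ (inj₂ refl)) = ℤ.≤-refl
    k≤1 : + k ℤ.≤ + 1
    k≤1 = begin
      + k                   ≡⟨ eq ⟩
      + d ℤ.* p ℤ.+ c       ≤⟨ ℤ.+-mono-≤ (ℤ.*-monoˡ-≤-nonNeg (+ d) p≤0) (c≤1 c∈) ⟩
      + d ℤ.* + 0 ℤ.+ + 1   ≡⟨ cong (ℤ._+ + 1) (ℤ.*-zeroʳ (+ d)) ⟩
      + 1                   ∎
      where open ℤ.≤-Reasoning

index-bound : ∀ {k d s} (p c : ℤ) → 2 ≤ k → (c ≡ ℤ.- (+ 1) ⊎ c ≡ + 0 ⊎ c ≡ + 1) →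
              + k ≡ + d ℤ.* p ℤ.+ c → + s ℤ.≤ + k ℤ.- p ℤ.+ + 1 → s ≤ k
index-bound {k} {s = s} (+ suc q) c _ _ _ s≤ = ℤ.drop‿+≤+ (begin
  + s                          ≤⟨ s≤ ⟩
  + k ℤ.- (+ 1 ℤ.+ + q) ℤ.+ + 1 ≡⟨ drop-one (+ k) (+ q) ⟩
  + k ℤ.- + q                  ≤⟨ ℤ.i-j≤i (+ k) (+ q) ⟩
  + k                          ∎)
  where
    open ℤ.≤-Reasoning
    drop-one : ∀ (k q : ℤ) → k ℤ.- (+ 1 ℤ.+ q) ℤ.+ + 1 ≡ k ℤ.- q
    drop-one = solve-∀
index-bound {d = d} (+ zero) c 2≤k c∈ eq _ = contradiction (ℤ.+≤+ z≤n) (quotient-positive {d = d} (+ 0) c 2≤k c∈ eq)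
index-bound {d = d} -[1+ q ] c 2≤k c∈ eq _ = contradiction ℤ.-≤+ (quotient-positive {d = d} -[1+ q ] c 2≤k c∈ eq)

reduce-inRange : ∀ n .{{_ : NonZero n}} z → 1 ≤ reduce n z × reduce n z ≤ n
reduce-inRange (suc n) z with z %ℕ suc n | n%ℕd<d z (suc n)
... | zero  | _   = s≤s z≤n , ≤-refl
... | suc r | r<n = s≤s z≤n , <⇒≤ r<n

reduce-% : ∀ n .{{_ : NonZero n}} z → reduce n z % n ≡ z %ℕ n
reduce-% (suc n) z with z %ℕ suc n | n%ℕd<d z (suc n)
... | zero  | _   = n%n≡0 (suc n)
... | suc r | r<n = m<n⇒m%n≡m r<n

CyclicOrder-rotate : ∀ {a b c d} → CyclicOrder a b c d → CyclicOrder b c d a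
CyclicOrder-rotate (inj₁ abcd)                 = inj₂ (inj₂ (inj₂ abcd))
CyclicOrder-rotate (inj₂ (inj₁ bcda))          = inj₁ bcda
CyclicOrder-rotate (inj₂ (inj₂ (inj₁ cdab)))   = inj₂ (inj₁ cdab)
CyclicOrder-rotate (inj₂ (inj₂ (inj₂ dabc)))   = inj₂ (inj₂ (inj₁ dabc))

CyclicOrder-pred : ∀ {a b c d} → 1 ≤ a → 1 ≤ b → 1 ≤ c → 1 ≤ d →
                   CyclicOrder a b c d → CyclicOrder (pred a) (pred b) (pred c) (pred d)
CyclicOrder-pred {suc _} {suc _} {suc _} {suc _} _ _ _ _ = lift
  where
    lift : ∀ {a b c d} → CyclicOrder (suc a) (suc b) (suc c) (suc d) → CyclicOrder a b c d
    lift (inj₁ (ab , bc , cd))               = inj₁ (s<s⁻¹ ab , s<s⁻¹ bc , s<s⁻¹ cd)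
    lift (inj₂ (inj₁ (bc , cd , da)))        = inj₂ (inj₁ (s<s⁻¹ bc , s<s⁻¹ cd , s<s⁻¹ da))
    lift (inj₂ (inj₂ (inj₁ (cd , da , ab)))) = inj₂ (inj₂ (inj₁ (s<s⁻¹ cd , s<s⁻¹ da , s<s⁻¹ ab)))
    lift (inj₂ (inj₂ (inj₂ (da , ab , bc)))) = inj₂ (inj₂ (inj₂ (s<s⁻¹ da , s<s⁻¹ ab , s<s⁻¹ bc)))

-- Rotating [0, n) by δ moves the points that wrap past n below all the
-- others, so the cyclic order of any four points is preserved.
module Rotation (n : ℕ) .{{_ : NonZero n}} (δ : ℕ) (δ<n : δ < n) where

  rot : ℕ → ℕ
  rot z = (z + δ) % n

  rot-unwrapped : ∀ {z} → z + δ < n → rot z ≡ z + δ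
  rot-unwrapped = m<n⇒m%n≡m

  rot-wrapped : ∀ {z} → z < n → n ≤ z + δ → rot z ≡ z + δ ∸ n
  rot-wrapped {z} z<n n≤z+δ = begin
    (z + δ) % n      ≡⟨ m≤n⇒[n∸m]%m≡n%m n≤z+δ ⟨
    (z + δ ∸ n) % n  ≡⟨ m<n⇒m%n≡m (+-cancelʳ-< n (z + δ ∸ n) n
                           (subst (_< n + n) (sym (m∸n+n≡m n≤z+δ)) (+-mono-< z<n δ<n))) ⟩
    z + δ ∸ n        ∎
    where open ≡-Reasoning

  rot-mono-unwrapped : ∀ {p q} → p < q → q + δ < n → rot p < rot q
  rot-mono-unwrapped {p} {q} p<q q+δ<n
    rewrite rot-unwrapped (<-trans (+-monoˡ-< δ p<q) q+δ<n) | rot-unwrapped q+δ<n = +-monoˡ-< δ p<q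

  rot-mono-wrapped : ∀ {p q} → p < q → q < n → n ≤ p + δ → rot p < rot q
  rot-mono-wrapped {p} {q} p<q q<n n≤p+δ
    rewrite rot-wrapped (<-trans p<q q<n) n≤p+δ | rot-wrapped q<n (≤-trans n≤p+δ (+-monoˡ-≤ δ (<⇒≤ p<q))) =
    ∸-monoˡ-< (+-monoˡ-< δ p<q) n≤p+δ

  rot-wrapped-below : ∀ {p q} → q < n → p + δ < n → n ≤ q + δ → rot q < rot p
  rot-wrapped-below {p} {q} q<n p+δ<n n≤q+δ rewrite rot-wrapped q<n n≤q+δ | rot-unwrapped p+δ<n = begin-strict
    q + δ ∸ n  <⟨ ∸-monoˡ-< (+-monoˡ-< δ q<n) n≤q+δ ⟩
    n + δ ∸ n  ≡⟨ m+n∸m≡n n δ ⟩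
    δ          ≤⟨ m≤n+m δ p ⟩
    p + δ      ∎
    where open ≤-Reasoning

  rot-increasing : ∀ {p q r s} → s < n → p < q × q < r × r < s → CyclicOrder (rot p) (rot q) (rot r) (rot s)
  rot-increasing {p} {q} {r} {s} s<n (p<q , q<r , r<s) with s + δ <? n | r + δ <? n | q + δ <? n | p + δ <? n
  ... | yes s+ | _ | _ | _ =
    inj₁ (rot-mono-unwrapped p<q (<-trans (+-monoˡ-< δ q<r) (<-trans (+-monoˡ-< δ r<s) s+)) ,
          rot-mono-unwrapped q<r (<-trans (+-monoˡ-< δ r<s) s+) , rot-mono-unwrapped r<s s+)
  ... | no s+ | yes r+ | _ | _ =
    inj₂ (inj₂ (inj₂ (rot-wrapped-below s<n (<-trans (+-monoˡ-< δ p<q) (<-trans (+-monoˡ-< δ q<r) r+)) (≮⇒≥ s+) ,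
                      rot-mono-unwrapped p<q (<-trans (+-monoˡ-< δ q<r) r+) , rot-mono-unwrapped q<r r+)))
  ... | no s+ | no r+ | yes q+ | _ =
    inj₂ (inj₂ (inj₁ (rot-mono-wrapped r<s s<n (≮⇒≥ r+) ,
                      rot-wrapped-below s<n (<-trans (+-monoˡ-< δ p<q) q+) (≮⇒≥ s+) , rot-mono-unwrapped p<q q+)))
  ... | no s+ | no r+ | no q+ | yes p+ =
    inj₂ (inj₁ (rot-mono-wrapped q<r (<-trans r<s s<n) (≮⇒≥ q+) , rot-mono-wrapped r<s s<n (≮⇒≥ r+) ,
                rot-wrapped-below s<n p+ (≮⇒≥ s+)))
  ... | no s+ | no r+ | no q+ | no p+ =
    inj₁ (rot-mono-wrapped p<q (<-trans q<r (<-trans r<s s<n)) (≮⇒≥ p+) ,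
          rot-mono-wrapped q<r (<-trans r<s s<n) (≮⇒≥ q+) , rot-mono-wrapped r<s s<n (≮⇒≥ r+))

  CyclicOrder-rot : ∀ {a b c d} → a < n → b < n → c < n → d < n →
                    CyclicOrder a b c d → CyclicOrder (rot a) (rot b) (rot c) (rot d)
  CyclicOrder-rot a<n b<n c<n d<n (inj₁ abcd) = rot-increasing d<n abcd
  CyclicOrder-rot a<n b<n c<n d<n (inj₂ (inj₁ bcda)) =
    CyclicOrder-rotate (CyclicOrder-rotate (CyclicOrder-rotate (rot-increasing a<n bcda)))
  CyclicOrder-rot a<n b<n c<n d<n (inj₂ (inj₂ (inj₁ cdab))) =
    CyclicOrder-rotate (CyclicOrder-rotate (rot-increasing b<n cdab))
  CyclicOrder-rot a<n b<n c<n d<n (inj₂ (inj₂ (inj₂ dabc))) = CyclicOrder-rotate (rot-increasing c<n dabc)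

-- The cycle [n]: offsets, induced successors and segments

iter-suc : ∀ j (f : ℕ → ℕ) x → iter j f (f x) ≡ f (iter j f x)
iter-suc zero    f x = refl
iter-suc (suc j) f x = cong f (iter-suc j f x)

orbit-snoc : ∀ (f : ℕ → ℕ) m x → orbit f (suc m) x ≡ orbit f m x ++ [ iter m f x ]
orbit-snoc f zero    x = refl
orbit-snoc f (suc m) x =
  cong (x ∷_) (trans (orbit-snoc f m (f x)) (cong (λ y → orbit f m (f x) ++ [ y ]) (iter-suc m f x)))

module Cycle (n : ℕ) .{{_ : NonZero n}} where

  InRange : ℕ → Set
  InRange z = 1 ≤ z × z ≤ n

  inRange⇔InRange : ∀ {z} → T (inRange n z) ⇔ InRange z
  inRange⇔InRange {z} = mk⇔
    (λ t → let (lo , hi) = Equivalence.to T-∧ t in ≤ᵇ⇒≤ 1 z lo , ≤ᵇ⇒≤ z n hi)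
    (λ (lo , hi) → Equivalence.from T-∧ (≤⇒≤ᵇ lo , ≤⇒≤ᵇ hi))

  offset : ℕ → ℕ → ℕ
  offset t z = (z + n ∸ t) % n

  offset<n : ∀ t z → offset t z < n
  offset<n t z = m%n<n (z + n ∸ t) n

  +-offset : ∀ {t} z → t ≤ n → (t + offset t z) % n ≡ z % n
  +-offset {t} z t≤n = begin
    (t + (z + n ∸ t) % n) % n  ≡⟨ [m+o%n]%n≡[m+o]%n t (z + n ∸ t) ⟩
    (t + (z + n ∸ t)) % n      ≡⟨ cong (_% n) (trans (+-comm t _) (m∸n+n≡m (≤-trans t≤n (m≤n+m n z)))) ⟩
    (z + n) % n                ≡⟨ [m+n]%n≡m%n z n ⟩
    z % n                      ∎
    where open ≡-Reasoning

  offset-unique : ∀ {t z u} → t ≤ n → u < n → (t + u) % n ≡ z % n → offset t z ≡ u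
  offset-unique {t} {z} t≤n u<n eq = +-cancelˡ-% t (offset<n t z) u<n (trans (+-offset z t≤n) (sym eq))

  offset-self : ∀ {t} → t ≤ n → offset t t ≡ 0
  offset-self {t} t≤n = offset-unique t≤n (>-nonZero⁻¹ n) (cong (_% n) (+-identityʳ t))

  offset-1 : ∀ {z} → InRange z → offset 1 z ≡ pred z
  offset-1 {suc z} (_ , z<n) = offset-unique (>-nonZero⁻¹ n) z<n refl

  offset-cocycle : ∀ {t u} z → t ≤ n → u ≤ n → offset u z ≡ (offset t z + offset u t) % n
  offset-cocycle {t} {u} z t≤n u≤n = offset-unique u≤n (m%n<n _ n) (begin
    (u + (offset t z + offset u t) % n) % n ≡⟨ [m+o%n]%n≡[m+o]%n u (offset t z + offset u t) ⟩
    (u + (offset t z + offset u t)) % n     ≡⟨ cong (_% n) (+-comm u _) ⟩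
    (offset t z + offset u t + u) % n       ≡⟨ cong (_% n) (+-assoc (offset t z) (offset u t) u) ⟩
    (offset t z + (offset u t + u)) % n     ≡⟨ cong (λ x → (offset t z + x) % n) (+-comm (offset u t) u) ⟩
    (offset t z + (u + offset u t)) % n     ≡⟨ [m+o%n]%n≡[m+o]%n (offset t z) (u + offset u t) ⟨
    (offset t z + (u + offset u t) % n) % n ≡⟨ cong (λ x → (offset t z + x) % n) (+-offset t u≤n) ⟩
    (offset t z + t % n) % n                ≡⟨ [m+o%n]%n≡[m+o]%n (offset t z) t ⟩
    (offset t z + t) % n                    ≡⟨ cong (_% n) (+-comm (offset t z) t) ⟩
    (t + offset t z) % n                    ≡⟨ +-offset z t≤n ⟩
    z % n                                   ∎)
    where open ≡-Reasoning

  offset-injective : ∀ {t z w} → t ≤ n → InRange z → InRange w → offset t z ≡ offset t w → z ≡ w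
  offset-injective {t} {z} {w} t≤n rz rw eq = %-injectiveOn-[1,n] (proj₁ rz) (proj₂ rz) (proj₁ rw) (proj₂ rw) (begin
    z % n                ≡⟨ +-offset z t≤n ⟨
    (t + offset t z) % n ≡⟨ cong (λ x → (t + x) % n) eq ⟩
    (t + offset t w) % n ≡⟨ +-offset w t≤n ⟩
    w % n                ∎)
    where open ≡-Reasoning

  offset-split : ∀ {t u} z → t ≤ n → u ≤ n → offset t u ≤ offset t z → offset t z ≡ offset u z + offset t u
  offset-split {t} {u} z t≤n u≤n le = begin
    offset t z                    ≡⟨ offset-cocycle z u≤n t≤n ⟩
    (offset u z + offset t u) % n ≡⟨ [m+o]%n≥o⇒[m+o]%n≡m+o (offset<n u z)
                                       (subst (offset t u ≤_) (offset-cocycle z u≤n t≤n) le) ⟩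
    offset u z + offset t u       ∎
    where open ≡-Reasoning

  CyclicOrder-offset : ∀ {t u a b c d} → t ≤ n → u ≤ n →
    CyclicOrder (offset t a) (offset t b) (offset t c) (offset t d) →
    CyclicOrder (offset u a) (offset u b) (offset u c) (offset u d)
  CyclicOrder-offset {t} {u} {a} {b} {c} {d} t≤n u≤n cyc
    rewrite offset-cocycle a t≤n u≤n | offset-cocycle b t≤n u≤n
          | offset-cocycle c t≤n u≤n | offset-cocycle d t≤n u≤n =
    Rotation.CyclicOrder-rot n (offset u t) (offset<n u t)
      (offset<n t a) (offset<n t b) (offset<n t c) (offset<n t d) cyc

  CyclicOrder-offset₁ : ∀ {a b c d} → InRange a → InRange b → InRange c → InRange d →
    CyclicOrder a b c d → CyclicOrder (offset 1 a) (offset 1 b) (offset 1 c) (offset 1 d)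
  CyclicOrder-offset₁ ra rb rc rd
    rewrite offset-1 ra | offset-1 rb | offset-1 rc | offset-1 rd =
    CyclicOrder-pred (proj₁ ra) (proj₁ rb) (proj₁ rc) (proj₁ rd)

  CyclicOrder⇒CyclicOrder-offset : ∀ {t a b c d} → t ≤ n →
    InRange a → InRange b → InRange c → InRange d → CyclicOrder a b c d →
    CyclicOrder (offset t a) (offset t b) (offset t c) (offset t d)
  CyclicOrder⇒CyclicOrder-offset t≤n ra rb rc rd =
    CyclicOrder-offset (>-nonZero⁻¹ n) t≤n ∘ CyclicOrder-offset₁ ra rb rc rd

  sucN-inRange : ∀ z → InRange (sucN n z)
  sucN-inRange z with z <ᵇ n in eq
  ... | true  = s≤s z≤n , <ᵇ⇒< z n (Equivalence.from T-≡ eq)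
  ... | false = ≤-refl , >-nonZero⁻¹ n

  sucN-% : ∀ {z} → z ≤ n → sucN n z % n ≡ suc z % n
  sucN-% {z} z≤n′ with z <ᵇ n in eq
  ... | true  = refl
  ... | false with m≤n⇒m<n∨m≡n z≤n′
  ...   | inj₁ z<n = contradiction (subst T eq (<⇒<ᵇ z<n)) λ ()
  ...   | inj₂ z≡n rewrite z≡n = sym ([m+n]%n≡m%n 1 n)

  offset-sucN : ∀ {t z} → t ≤ n → z ≤ n → offset t (sucN n z) ≡ suc (offset t z) % n
  offset-sucN {t} {z} t≤n z≤n′ = offset-unique t≤n (m%n<n _ n) (begin
    (t + suc (offset t z) % n) % n ≡⟨ [m+o%n]%n≡[m+o]%n t (suc (offset t z)) ⟩
    (t + suc (offset t z)) % n     ≡⟨ cong (_% n) (+-suc t (offset t z)) ⟩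
    (1 + (t + offset t z)) % n     ≡⟨ [m+o%n]%n≡[m+o]%n 1 (t + offset t z) ⟨
    (1 + (t + offset t z) % n) % n ≡⟨ cong (λ x → (1 + x) % n) (+-offset z t≤n) ⟩
    (1 + z % n) % n                ≡⟨ [m+o%n]%n≡[m+o]%n 1 z ⟩
    suc z % n                      ≡⟨ sucN-% z≤n′ ⟨
    sucN n z % n                   ∎)
    where open ≡-Reasoning

  sucN^ : ℕ → ℕ → ℕ
  sucN^ j = iter j (sucN n)

  sucN^-inRange : ∀ {q} j → InRange q → InRange (sucN^ j q)
  sucN^-inRange zero    rq = rq
  sucN^-inRange {q} (suc j) rq = sucN-inRange (sucN^ j q)

  offset-sucN^ : ∀ {q} j → InRange q → offset q (sucN^ j q) ≡ j % n
  offset-sucN^ zero    (_ , q≤n) = trans (offset-self q≤n) (sym (m<n⇒m%n≡m (>-nonZero⁻¹ n)))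
  offset-sucN^ {q} (suc j) rq = begin
    offset q (sucN n (sucN^ j q)) ≡⟨ offset-sucN (proj₂ rq) (proj₂ (sucN^-inRange j rq)) ⟩
    suc (offset q (sucN^ j q)) % n ≡⟨ cong (λ x → suc x % n) (offset-sucN^ j rq) ⟩
    (1 + j % n) % n               ≡⟨ [m+o%n]%n≡[m+o]%n 1 j ⟩
    suc j % n                     ∎
    where open ≡-Reasoning

  sucN^offset : ∀ {x z} → InRange x → InRange z → sucN^ (offset x z) x ≡ z
  sucN^offset {x} {z} rx rz = offset-injective (proj₂ rx) (sucN^-inRange (offset x z) rx) rz
    (trans (offset-sucN^ (offset x z) rx) (m<n⇒m%n≡m (offset<n x z)))

  sucN^n : ∀ {x} → InRange x → sucN^ n x ≡ x
  sucN^n {x} rx = offset-injective (proj₂ rx) (sucN^-inRange n rx) rx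
    (trans (offset-sucN^ n rx) (trans (n%n≡0 n) (sym (offset-self (proj₂ rx)))))

  offset≡0⇒≡ : ∀ {x z} → InRange x → InRange z → offset x z ≡ 0 → x ≡ z
  offset≡0⇒≡ rx rz eq = offset-injective (proj₂ rx) rx rz (trans (offset-self (proj₂ rx)) (sym eq))

  0<offset⇒≢ : ∀ {x z} → x ≤ n → 0 < offset x z → x ≢ z
  0<offset⇒≢ x≤n 0<offset refl = <-irrefl (sym (offset-self x≤n)) 0<offset

  offset-positive : ∀ {x z} → InRange x → InRange z → x ≢ z → 0 < offset x z
  offset-positive {x} {z} rx rz x≢z with offset x z in eq
  ... | zero  = contradiction (offset≡0⇒≡ rx rz eq) x≢z
  ... | suc _ = s≤s z≤n

  sucN^-reaches : ∀ {x z} → InRange x → InRange z → ∃ λ i → 1 ≤ i × i ≤ n × sucN^ i x ≡ z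
  sucN^-reaches {x} {z} rx rz with offset x z in eq
  ... | zero  = n , >-nonZero⁻¹ n , ≤-refl , trans (sucN^n rx) (offset≡0⇒≡ rx rz eq)
  ... | suc o = suc o , s≤s z≤n , subst (_≤ n) eq (<⇒≤ (offset<n x z)) ,
                trans (cong (λ i → sucN^ i x) (sym eq)) (sucN^offset rx rz)

  module Induced (Q : Subset) where

    S : ℕ → ℕ
    S = indSuc n Q

    seek-hit : ∀ f q {i} → 1 ≤ i → i ≤ f → T (Q (sucN^ i q)) →
               ∃ λ j → 1 ≤ j × j ≤ i × seek n Q f q ≡ sucN^ j q × T (Q (seek n Q f q))
    seek-hit (suc f) q {suc i} _ (s≤s i≤f) hit with Q (sucN n q) in eq
    ... | true  = 1 , ≤-refl , s≤s z≤n , refl , Equivalence.from T-≡ eq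
    ... | false with i
    ...   | zero   = contradiction (subst T eq hit) λ ()
    ...   | suc i′ =
      let (j , 1≤j , j≤i , seek≡ , hitQ) =
            seek-hit f (sucN n q) (s≤s z≤n) i≤f (subst (T ∘ Q ∘ sucN n) (sym (iter-suc i′ (sucN n) q)) hit)
      in suc j , s≤s z≤n , s≤s j≤i , trans seek≡ (iter-suc j (sucN n) q) , hitQ

    S-∈ : ∀ {x z} → InRange x → InRange z → T (Q z) → InRange (S x) × T (Q (S x))
    S-∈ {x} rx rz qz =
      let (i , 1≤i , i≤n , reach) = sucN^-reaches rx rz
          (j , _ , _ , Sx≡ , qSx) = seek-hit n x 1≤i i≤n (subst (T ∘ Q) (sym reach) qz)
      in subst InRange (sym Sx≡) (sucN^-inRange j rx) , qSx

    S-between : ∀ {x z} → InRange x → InRange z → T (Q z) → x ≢ z →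
                0 < offset x (S x) × offset x (S x) ≤ offset x z
    S-between {x} {z} rx rz qz x≢z =
      let (j , 1≤j , j≤i , Sx≡ , _) =
            seek-hit n x (offset-positive rx rz x≢z) (<⇒≤ (offset<n x z))
              (subst (T ∘ Q) (sym (sucN^offset rx rz)) qz)
          offset≡j : offset x (S x) ≡ j
          offset≡j = begin
            offset x (S x)        ≡⟨ cong (offset x) Sx≡ ⟩
            offset x (sucN^ j x)  ≡⟨ offset-sucN^ j rx ⟩
            j % n                 ≡⟨ m<n⇒m%n≡m (≤-<-trans j≤i (offset<n x z)) ⟩
            j                     ∎
      in subst (0 <_) (sym offset≡j) 1≤j , subst (_≤ offset x z) (sym offset≡j) j≤i
      where open ≡-Reasoning

    S-closer : ∀ {x z} → InRange x → InRange z → T (Q z) → x ≢ z → offset (S x) z < offset x z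
    S-closer {x} {z} rx rz qz x≢z =
      let (0<gap , gap≤) = S-between rx rz qz x≢z
          rSx = proj₁ (S-∈ rx rz qz)
      in subst (offset (S x) z <_) (sym (offset-split z (proj₂ rx) (proj₂ rSx) gap≤))
           (m<m+n (offset (S x) z) 0<gap)

    S-first-after : ∀ {i l z} → InRange i → InRange l → InRange z → T (Q z) → offset i l < offset i z →
                    offset i l < offset i (S l) × offset i (S l) ≤ offset i z
    S-first-after {i} {l} {z} ri rl rz qz l<z =
      subst (offset i l <_) (sym offset≡) (m<n+m (offset i l) (proj₁ between)) ,
      subst (_≤ offset i z) (sym offset≡) gap+≤
      where
        l≢z : l ≢ z
        l≢z refl = <-irrefl refl l<z
        gap : ℕ
        gap = offset l (S l)
        between : 0 < gap × gap ≤ offset l z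
        between = S-between rl rz qz l≢z
        split : offset i z ≡ offset l z + offset i l
        split = offset-split z (proj₂ ri) (proj₂ rl) (<⇒≤ l<z)
        gap+≤ : gap + offset i l ≤ offset i z
        gap+≤ = subst (gap + offset i l ≤_) (sym split) (+-monoˡ-≤ (offset i l) (proj₂ between))
        offset≡ : offset i (S l) ≡ gap + offset i l
        offset≡ = trans (offset-cocycle (S l) (proj₂ rl) (proj₂ ri))
                        (m<n⇒m%n≡m (≤-<-trans gap+≤ (offset<n i z)))

    Before : ℕ → ℕ → ℕ → Set
    Before i L z = InRange z × T (Q z) × offset i z < L

    module Orbit {i : ℕ} (ri : InRange i) (qi : T (Q i)) where

      S^-∈ : ∀ m → InRange (iter m S i) × T (Q (iter m S i))
      S^-∈ zero    = ri , qi
      S^-∈ (suc m) = S-∈ (proj₁ (S^-∈ m)) ri qi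

      reach : ℕ → ℕ
      reach m = offset i (iter m S i)

      -- L is either the offset of the next point of the orbit, or n once the orbit has run through all of Q.
      OrbitIsSegment : ℕ → Set
      OrbitIsSegment m = ∃ λ L → (∀ z → z ∈ orbit S m i ⇔ Before i L z) × (L ≡ reach m ⊎ L ≡ n)

      beyond-reach : ∀ {m z} → InRange z → T (Q z) → reach m < offset i z →
                     reach m < reach (suc m) × reach (suc m) ≤ offset i z
      beyond-reach {m} rz qz = S-first-after ri (proj₁ (S^-∈ m)) rz qz

      orbit-extend : ∀ {m L L′} → (∀ z → z ∈ orbit S m i → Before i L z) → L ≤ L′ →
                     reach m < L′ → ∀ z → z ∈ orbit S (suc m) i → Before i L′ z
      orbit-extend {m} {L} hyp L≤L′ last< z z∈ with ∈-++⁻ (orbit S m i) (subst (z ∈_) (orbit-snoc S m i) z∈)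
      ... | inj₁ z∈m = let (rz , qz , z<L) = hyp z z∈m in rz , qz , <-≤-trans z<L L≤L′
      ... | inj₂ (here refl) = proj₁ (S^-∈ m) , proj₂ (S^-∈ m) , last<

      orbit-collect : ∀ {m} → (∀ z → Before i (reach m) z → z ∈ orbit S m i) →
                      ∀ {z} → InRange z → T (Q z) → offset i z ≤ reach m → z ∈ orbit S (suc m) i
      orbit-collect {m} hyp {z} rz qz z≤last = subst (z ∈_) (sym (orbit-snoc S m i)) (collect (m≤n⇒m<n∨m≡n z≤last))
        where
          collect : offset i z < reach m ⊎ offset i z ≡ reach m → z ∈ orbit S m i ++ [ iter m S i ]
          collect (inj₁ z<last) = ∈-++⁺ˡ (hyp z (rz , qz , z<last))
          collect (inj₂ z≡last) =
            ∈-++⁺ʳ (orbit S m i) (here (offset-injective (proj₂ ri) rz (proj₁ (S^-∈ m)) z≡last))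

      from-reach : ∀ {m L} → (∀ z → z ∈ orbit S m i ⇔ Before i L z) → L ≡ reach m →
                   ∀ z → Before i (reach m) z → z ∈ orbit S m i
      from-reach mem refl z = Equivalence.from (mem z)

      orbit-step : ∀ {m} → OrbitIsSegment m → OrbitIsSegment (suc m)
      orbit-step {m} (L , mem , inj₂ L≡n) =
        L , (λ z → mk⇔ (orbit-extend (λ z → Equivalence.to (mem z)) ≤-refl reach<L z) grow) , inj₂ L≡n
        where
          reach<L : reach m < L
          reach<L = subst (reach m <_) (sym L≡n) (offset<n i _)
          grow : ∀ {z} → Before i L z → z ∈ orbit S (suc m) i
          grow {z} b = subst (z ∈_) (sym (orbit-snoc S m i)) (∈-++⁺ˡ (Equivalence.from (mem z) b))
      orbit-step {m} (L , mem , inj₁ L≡reach) with reach m <? reach (suc m)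
      ... | yes advance =
        reach (suc m) ,
        (λ z → mk⇔ (orbit-extend (λ z → Equivalence.to (mem z))
                                 (≤-trans (≤-reflexive L≡reach) (<⇒≤ advance)) advance z)
                   from-next) ,
        inj₁ refl
        where
          from-next : ∀ {z} → Before i (reach (suc m)) z → z ∈ orbit S (suc m) i
          from-next {z} (rz , qz , z<next) with offset i z ≤? reach m
          ... | yes z≤reach = orbit-collect {m} (from-reach mem L≡reach) rz qz z≤reach
          ... | no z≰reach = contradiction (proj₂ (beyond-reach {m} rz qz (≰⇒> z≰reach))) (<⇒≱ z<next)
      ... | no wrap =
        n ,
        (λ z → mk⇔ (orbit-extend (λ z → Equivalence.to (mem z))
                                 (subst (_≤ n) (sym L≡reach) (<⇒≤ (offset<n i _))) (offset<n i _) z)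
                   from-all) ,
        inj₂ refl
        where
          from-all : ∀ {z} → Before i n z → z ∈ orbit S (suc m) i
          from-all {z} (rz , qz , _) with offset i z ≤? reach m
          ... | yes z≤reach = orbit-collect {m} (from-reach mem L≡reach) rz qz z≤reach
          ... | no z≰reach = contradiction (proj₁ (beyond-reach {m} rz qz (≰⇒> z≰reach))) wrap

      orbit-isSegment : ∀ m → OrbitIsSegment m
      orbit-isSegment zero    = 0 , (λ z → mk⇔ (λ ()) (λ ())) , inj₁ (sym (offset-self (proj₂ ri)))
      orbit-isSegment (suc m) = orbit-step (orbit-isSegment m)

  Segment : (P C : Subset) → ℕ → ℕ → ℕ → ℕ → Set
  Segment P C t L M z = InRange z × T (P z) × offset t z < L × (T (C z) → offset t z < M)

  module _ {P C : Subset} {t L M : ℕ} where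

    ∉Segment-cut : ∀ {z} → InRange z → T (P z) → offset t z < L → ¬ Segment P C t L M z →
                   T (C z) × M ≤ offset t z
    ∉Segment-cut {z} rz pz z<L z∉ with T? (C z)
    ... | no ¬cz = contradiction (rz , pz , z<L , λ cz → contradiction cz ¬cz) z∉
    ... | yes cz with offset t z <? M
    ...   | yes z<M = contradiction (rz , pz , z<L , λ _ → z<M) z∉
    ...   | no z≮M = cz , ≮⇒≥ z≮M

    ∉Segment-uncut : ∀ {z} → InRange z → T (P z) → ¬ T (C z) → ¬ Segment P C t L M z → L ≤ offset t z
    ∉Segment-uncut {z} rz pz ¬cz z∉ with offset t z <? L
    ... | yes z<L = contradiction (rz , pz , z<L , λ cz → contradiction cz ¬cz) z∉
    ... | no z≮L = ≮⇒≥ z≮L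

  module TwoSegments {P C : Subset} {t L M t′ L′ M′ : ℕ} (t≤n : t ≤ n) (t′≤n : t′ ≤ n) where

    A B : ℕ → Set
    A = Segment P C t L M
    B = Segment P C t′ L′ M′

    o o′ : ℕ → ℕ
    o  = offset t
    o′ = offset t′

    cut-before : ∀ {x c} → B x → ¬ A x → A c → o x < o c → T (C x) × M ≤ o x
    cut-before (rx , px , _) x∉A (_ , _ , c<L , _) x<c = ∉Segment-cut {P} {C} {t} rx px (<-trans x<c c<L) x∉A

    -- c lies beyond M ≤ o x, so c ∉ C, and then c ∉ B forces o′ c ≥ L′.
    beyond-L′ : ∀ {x c} → B x → ¬ A x → A c → ¬ B c → o x < o c → L′ ≤ o′ c
    beyond-L′ x∈B x∉A c∈A@(rc , pc , _ , c-cut) c∉B x<c =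
      ∉Segment-uncut {P} {C} {t′} rc pc
        (λ cc → <⇒≱ (c-cut cc) (≤-trans (proj₂ (cut-before x∈B x∉A c∈A x<c)) (<⇒≤ x<c))) c∉B

    no-ABAB : ∀ {a x c y} → o a < o x → o x < o c → o c < o y →
              A a → ¬ B a → B x → ¬ A x → A c → ¬ B c → B y → ¬ A y → ⊥
    no-ABAB {a} {x} {c} {y} a<x x<c c<y
            (ra , pa , _) a∉B x∈B@(_ , _ , x<L′ , x-cut) x∉A c∈A c∉B (_ , _ , y<L′ , _) _ =
      order (CyclicOrder-offset t≤n t′≤n (inj₁ (a<x , x<c , c<y)))
      where
        L′≤c : L′ ≤ o′ c
        L′≤c = beyond-L′ x∈B x∉A c∈A c∉B x<c
        order : CyclicOrder (o′ a) (o′ x) (o′ c) (o′ y) → ⊥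
        order (inj₁ (_ , _ , c<y′))               = <⇒≱ (<-≤-trans y<L′ L′≤c) (<⇒≤ c<y′)
        order (inj₂ (inj₁ (_ , c<y′ , _)))        = <⇒≱ (<-≤-trans y<L′ L′≤c) (<⇒≤ c<y′)
        order (inj₂ (inj₂ (inj₁ (c<y′ , y<a′ , a<x′)))) =
          <⇒≱ (<-≤-trans x<L′ L′≤c) (<⇒≤ (<-trans c<y′ (<-trans y<a′ a<x′)))
        order (inj₂ (inj₂ (inj₂ (_ , a<x′ , _)))) =
          <⇒≱ (x-cut (proj₁ (cut-before x∈B x∉A c∈A x<c)))
              (≤-trans (proj₂ (∉Segment-cut {P} {C} {t′} ra pa (<-trans a<x′ x<L′) a∉B)) (<⇒≤ a<x′))

    no-BABA : ∀ {y a x c} → o y < o a → o a < o x → o x < o c →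
              B y → ¬ A y → A a → ¬ B a → B x → ¬ A x → A c → ¬ B c → ⊥
    no-BABA {y} {a} {x} {c} y<a a<x x<c
            y∈B@(_ , _ , y<L′ , _) y∉A a∈A a∉B x∈B@(_ , _ , x<L′ , _) x∉A c∈A c∉B =
      order (CyclicOrder-offset t≤n t′≤n (inj₁ (y<a , a<x , x<c)))
      where
        L′≤a : L′ ≤ o′ a
        L′≤a = beyond-L′ y∈B y∉A a∈A a∉B y<a
        L′≤c : L′ ≤ o′ c
        L′≤c = beyond-L′ x∈B x∉A c∈A c∉B x<c
        order : CyclicOrder (o′ y) (o′ a) (o′ x) (o′ c) → ⊥
        order (inj₁ (_ , a<x′ , _))               = <⇒≱ (<-≤-trans x<L′ L′≤a) (<⇒≤ a<x′)
        order (inj₂ (inj₁ (a<x′ , _ , _)))        = <⇒≱ (<-≤-trans x<L′ L′≤a) (<⇒≤ a<x′)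
        order (inj₂ (inj₂ (inj₁ (_ , c<y′ , _)))) = <⇒≱ (<-≤-trans y<L′ L′≤c) (<⇒≤ c<y′)
        order (inj₂ (inj₂ (inj₂ (c<y′ , _ , _)))) = <⇒≱ (<-≤-trans y<L′ L′≤c) (<⇒≤ c<y′)

    noncrossing : ∀ {I J} → (∀ z → z ∈ I ⇔ A z) → (∀ z → z ∈ J ⇔ B z) → Noncrossing I J
    noncrossing {I} {J} I≡A J≡B
                (a , b , c , d , cyc , (a∈I , a∉J) , (c∈I , c∉J) , (b∈J , b∉I) , (d∈J , d∉I)) =
      order (CyclicOrder⇒CyclicOrder-offset t≤n (proj₁ a∈A) (proj₁ b∈B) (proj₁ c∈A) (proj₁ d∈B) cyc)
      where
        in-A : ∀ {z} → z ∈ I → A z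
        in-A = Equivalence.to (I≡A _)
        in-B : ∀ {z} → z ∈ J → B z
        in-B = Equivalence.to (J≡B _)
        out-A : ∀ {z} → ¬ z ∈ I → ¬ A z
        out-A z∉I = z∉I ∘ Equivalence.from (I≡A _)
        out-B : ∀ {z} → ¬ z ∈ J → ¬ B z
        out-B z∉J = z∉J ∘ Equivalence.from (J≡B _)
        a∈A : A a
        a∈A = in-A a∈I
        b∈B : B b
        b∈B = in-B b∈J
        c∈A : A c
        c∈A = in-A c∈I
        d∈B : B d
        d∈B = in-B d∈J
        order : CyclicOrder (o a) (o b) (o c) (o d) → ⊥
        order (inj₁ (ab , bc , cd)) =
          no-ABAB ab bc cd a∈A (out-B a∉J) b∈B (out-A b∉I) c∈A (out-B c∉J) d∈B (out-A d∉I)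
        order (inj₂ (inj₁ (bc , cd , da))) =
          no-BABA bc cd da b∈B (out-A b∉I) c∈A (out-B c∉J) d∈B (out-A d∉I) a∈A (out-B a∉J)
        order (inj₂ (inj₂ (inj₁ (cd , da , ab)))) =
          no-ABAB cd da ab c∈A (out-B c∉J) d∈B (out-A d∉I) a∈A (out-B a∉J) b∈B (out-A b∉I)
        order (inj₂ (inj₂ (inj₂ (da , ab , bc)))) =
          no-BABA da ab bc d∈B (out-A d∉I) a∈A (out-B a∉J) b∈B (out-A b∉I) c∈A (out-B c∉J)

-- The sets I(i, h) and their translates

module Construction (k′ d′ : ℕ) (a : ℕ → ℕ) (s : ℕ) (1≤s : 1 ≤ s) (s≤k : s ≤ suc k′)
  (a-range : ∀ i → 1 ≤ i → i ≤ suc k′ → 1 ≤ a i × a i ≤ suc k′)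
  (a-injective : ∀ i j → 1 ≤ i → i ≤ suc k′ → 1 ≤ j → j ≤ suc k′ → a i ≡ a j → i ≡ j) where

  k d n : ℕ
  k = suc k′
  d = suc d′
  n = d * k

  open Cycle n public

  α : ℕ
  α = a s

  C Ps : Subset
  C  = cls n k α
  Ps = P n k a s

  k≤n : k ≤ n
  k≤n = m≤m+n k (d′ * k)

  k∣n : k ∣ n
  k∣n = divides d refl

  α-inRange : InRange α
  α-inRange = proj₁ (a-range s 1≤s s≤k) , ≤-trans (proj₂ (a-range s 1≤s s≤k)) k≤n

  inRange-true : ∀ {z} → InRange z → inRange n z ≡ true
  inRange-true rz = Equivalence.to T-≡ (Equivalence.from inRange⇔InRange rz)

  C⇔ : ∀ z → T (C z) ⇔ (InRange z × z % k ≡ α % k)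
  C⇔ z = mk⇔
    (λ cz → let (rz , ≡ᵇ) = Equivalence.to T-∧ cz in Equivalence.to inRange⇔InRange rz , ≡ᵇ⇒≡ _ _ ≡ᵇ)
    (λ (rz , eq) → Equivalence.from T-∧ (Equivalence.from inRange⇔InRange rz , ≡⇒≡ᵇ _ _ eq))

  C-resp : ∀ {z w} → InRange z → InRange w → z % k ≡ w % k → C z ≡ C w
  C-resp rz rw eq = cong₂ (λ b r → b ∧ (r ≡ᵇ α % k)) (trans (inRange-true rz) (sym (inRange-true rw))) eq

  Ps-resp : ∀ {z w} → InRange z → InRange w → z % k ≡ w % k → Ps z ≡ Ps w
  Ps-resp rz rw eq =
    cong₂ (λ b r → b ∧ not (any (λ i → b ∧ (r ≡ᵇ a i % k)) (oneTo (s ∸ 1))))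
          (trans (inRange-true rz) (sym (inRange-true rw))) eq

  α+m*k-inRange : ∀ {m} → m < d → InRange (α + m * k)
  α+m*k-inRange {m} m<d =
    ≤-trans (proj₁ α-inRange) (m≤m+n α (m * k)) ,
    ≤-trans (+-monoˡ-≤ (m * k) (proj₂ (a-range s 1≤s s≤k))) (*-monoˡ-≤ k m<d)

  α+m*k∈C : ∀ {m} → m < d → T (C (α + m * k))
  α+m*k∈C {m} m<d = Equivalence.from (C⇔ (α + m * k)) (α+m*k-inRange m<d , [m+kn]%n≡m%n α m k)

  -- Write z − 1 = r + m k with r < k; the representative r + 1 ∈ [1, k] of z must be α.
  C⇒α+m*k : ∀ {z} → T (C z) → ∃ λ m → m < d × z ≡ α + m * k
  C⇒α+m*k {zero}   cz = contradiction (proj₁ (proj₁ (Equivalence.to (C⇔ 0) cz))) λ ()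
  C⇒α+m*k {suc z′} cz = m , m<d , z≡
    where
      z : ℕ
      z = suc z′
      z≤n′ : z ≤ n
      z≤n′ = proj₂ (proj₁ (Equivalence.to (C⇔ z) cz))
      z≡α : z % k ≡ α % k
      z≡α = proj₂ (Equivalence.to (C⇔ z) cz)
      m r : ℕ
      m = z′ / k
      r = suc (z′ % k)
      z≡r+m*k : z ≡ r + m * k
      z≡r+m*k = cong suc (m≡m%n+[m/n]*n z′ k)
      r≡α : r ≡ α
      r≡α = %-injectiveOn-[1,n] (s≤s z≤n) (m%n<n z′ k) (proj₁ (a-range s 1≤s s≤k)) (proj₂ (a-range s 1≤s s≤k))
              (trans (sym ([m+kn]%n≡m%n r m k)) (trans (cong (_% k) (sym z≡r+m*k)) z≡α))
      m<d : m < d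
      m<d = *-cancelʳ-< k m d (≤-<-trans (m/n*n≤m z′ k) z≤n′)
      z≡ : z ≡ α + m * k
      z≡ = trans z≡r+m*k (cong (_+ m * k) r≡α)

  offset-C : ∀ {q z} → InRange q → T (C q) → T (C z) → offset q z % k ≡ 0
  offset-C {q} {z} rq cq cz = +-cancelˡ-% q (m%n<n (offset q z) k) (>-nonZero⁻¹ k) (begin
    (q + offset q z % k) % k ≡⟨ [m+o%n]%n≡[m+o]%n q (offset q z) ⟩
    (q + offset q z) % k     ≡⟨ m∣n⇒o%n%m≡o%m k n (q + offset q z) k∣n ⟨
    (q + offset q z) % n % k ≡⟨ cong (_% k) (+-offset z (proj₂ rq)) ⟩
    z % n % k                ≡⟨ m∣n⇒o%n%m≡o%m k n z k∣n ⟩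
    z % k                    ≡⟨ proj₂ (Equivalence.to (C⇔ z) cz) ⟩
    α % k                    ≡⟨ proj₂ (Equivalence.to (C⇔ q) cq) ⟨
    q % k                    ≡⟨ cong (_% k) (+-identityʳ q) ⟨
    (q + 0) % k              ∎)
    where open ≡-Reasoning

  open Induced C using () renaming (S to S-C; S-between to S-C-between; S-∈ to S-C-∈)

  S-C-step : ∀ {m} → suc m < d → S-C (α + m * k) ≡ α + suc m * k
  S-C-step {m} sm<d = offset-injective (proj₂ rq) (proj₁ (S-C-∈ rq rq′ cq′)) rq′ (trans offset≡k (sym offset-q′))
    where
      q q′ : ℕ
      q  = α + m * k
      q′ = α + suc m * k
      m<d : m < d
      m<d = <-trans (n<1+n m) sm<d
      rq : InRange q
      rq = α+m*k-inRange m<d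
      rq′ : InRange q′
      rq′ = α+m*k-inRange sm<d
      cq : T (C q)
      cq = α+m*k∈C m<d
      cq′ : T (C q′)
      cq′ = α+m*k∈C sm<d
      q+k≡q′ : q + k ≡ q′
      q+k≡q′ = trans (+-assoc α (m * k) k) (cong (_+_ α) (+-comm (m * k) k))
      offset-q′ : offset q q′ ≡ k
      offset-q′ = offset-unique (proj₂ rq) (subst (k <_) (*-comm k d) (m<m*n k d (≤-trans (s≤s (s≤s z≤n)) sm<d)))
                    (cong (_% n) q+k≡q′)
      between : 0 < offset q (S-C q) × offset q (S-C q) ≤ offset q q′
      between = S-C-between rq rq′ cq′ (0<offset⇒≢ (proj₂ rq) (subst (0 <_) (sym offset-q′) (>-nonZero⁻¹ k)))
      offset≡k : offset q (S-C q) ≡ k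
      offset≡k = %-injectiveOn-[1,n] (proj₁ between) (subst (offset q (S-C q) ≤_) offset-q′ (proj₂ between))
                   (>-nonZero⁻¹ k) ≤-refl
                   (trans (offset-C rq cq (proj₂ (S-C-∈ rq rq′ cq′))) (sym (n%n≡0 k)))

  S-C^ : ∀ {m} → m < d → iter m S-C α ≡ α + m * k
  S-C^ {zero}  _    = sym (+-identityʳ α)
  S-C^ {suc m} sm<d = trans (cong S-C (S-C^ (<-trans (n<1+n m) sm<d))) (S-C-step sm<d)

  α∈Ps : T (Ps α)
  α∈Ps = Equivalence.from T-∧ (Equivalence.from inRange⇔InRange α-inRange , T-not-any)
    where
      earlier-class : ∀ {i} → i ∈ oneTo (s ∸ 1) → ¬ T (cls n k (a i) α)
      earlier-class {i} i∈ ci with ∈-map⁻ suc i∈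
      ... | j , j∈ , refl = <-irrefl (sym s≡i) i<s
        where
          i<s : suc j < s
          i<s = subst₂ _≤_ (+-comm (suc j) 1) (m∸n+n≡m 1≤s) (+-monoˡ-≤ 1 (∈-upTo⁻ j∈))
          i≤k : suc j ≤ k
          i≤k = ≤-trans (<⇒≤ i<s) s≤k
          ai-range : 1 ≤ a (suc j) × a (suc j) ≤ k
          ai-range = a-range (suc j) (s≤s z≤n) i≤k
          s≡i : s ≡ suc j
          s≡i = a-injective s (suc j) 1≤s s≤k (s≤s z≤n) i≤k
                  (%-injectiveOn-[1,n] (proj₁ α-inRange) (proj₂ (a-range s 1≤s s≤k)) (proj₁ ai-range) (proj₂ ai-range)
                    (≡ᵇ⇒≡ _ _ (proj₂ (Equivalence.to T-∧ ci))))
      T-not-any : T (not (any (λ i → cls n k (a i) α) (oneTo (s ∸ 1))))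
      T-not-any = Equivalence.from T-not⇔¬T λ t → let (i , i∈ , ci) = find (any⁻ _ _ t) in earlier-class i∈ ci

  open Induced Ps using () renaming (S to S-Ps; S-∈ to S-Ps-∈; S-closer to S-Ps-closer)

  w₀ : ℕ
  w₀ = α ⊕[ n ] (+ (n ∸ k))

  w₀-inRange : InRange w₀
  w₀-inRange = reduce-inRange n (+ (α + (n ∸ k)))

  offset-w₀ : k < n → offset w₀ α ≡ k
  offset-w₀ k<n = offset-unique (proj₂ w₀-inRange) k<n (begin
    (w₀ + k) % n                ≡⟨ [m%n+o]%n≡[m+o]%n w₀ k ⟨
    (w₀ % n + k) % n            ≡⟨ cong (λ x → (x + k) % n) (reduce-% n (+ (α + (n ∸ k)))) ⟩
    ((α + (n ∸ k)) % n + k) % n ≡⟨ [m%n+o]%n≡[m+o]%n (α + (n ∸ k)) k ⟩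
    (α + (n ∸ k) + k) % n       ≡⟨ cong (_% n) (trans (+-assoc α (n ∸ k) k) (cong (_+_ α) (m∸n+n≡m k≤n))) ⟩
    (α + n) % n                 ≡⟨ [m+n]%n≡m%n α n ⟩
    α % n                       ∎)
    where open ≡-Reasoning

  -- Each step of the index interval brings i closer to α, starting fewer than k steps before it.
  InIdx⇒window : ∀ {i} → InIdx n k a s i → InRange i × T (Ps i) × offset i α < k
  InIdx⇒window = go
    where
      next-∈ : ∀ {z} → InRange z → InRange (S-Ps z) × T (Ps (S-Ps z))
      next-∈ rz = S-Ps-∈ rz α-inRange α∈Ps
      first : offset (S-Ps w₀) α < k
      first with m≤n⇒m<n∨m≡n k≤n
      ... | inj₁ k<n = subst (offset (S-Ps w₀) α <_) (offset-w₀ k<n)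
                         (S-Ps-closer w₀-inRange α-inRange α∈Ps
                           (0<offset⇒≢ (proj₂ w₀-inRange) (subst (0 <_) (sym (offset-w₀ k<n)) (>-nonZero⁻¹ k))))
      ... | inj₂ k≡n = subst (offset (S-Ps w₀) α <_) (sym k≡n) (offset<n (S-Ps w₀) α)
      go : ∀ {z} → Interval S-Ps (S-Ps w₀) α z → InRange z × T (Ps z) × offset z α < k
      go left = proj₁ (next-∈ w₀-inRange) , proj₂ (next-∈ w₀-inRange) , first
      go right = α-inRange , α∈Ps , subst (_< k) (sym (offset-self (proj₂ α-inRange))) (>-nonZero⁻¹ k)
      go (step p z≢α) =
        let (rz , _ , z<k) = go p
        in proj₁ (next-∈ rz) , proj₂ (next-∈ rz) , <-trans (S-Ps-closer rz α-inRange α∈Ps z≢α) z<k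

  -- Seen from i, the points α + m k of C follow each other at offsets offset i α + m k, so
  -- removing those with m ≥ h from Ps cuts C off at offset offset i α + h k.
  module Window {i : ℕ} (ri : InRange i) (pi : T (Ps i)) (α-near : offset i α < k) where

    offset-α+m*k : ∀ {m} → m < d → offset i (α + m * k) ≡ offset i α + m * k
    offset-α+m*k {m} m<d = offset-unique (proj₂ ri) (<-≤-trans (+-monoˡ-< (m * k) α-near) (*-monoˡ-≤ k m<d)) (begin
      (i + (offset i α + m * k)) % n     ≡⟨ cong (_% n) (+-assoc i (offset i α) (m * k)) ⟨
      (i + offset i α + m * k) % n       ≡⟨ [m%n+o]%n≡[m+o]%n (i + offset i α) (m * k) ⟨
      ((i + offset i α) % n + m * k) % n ≡⟨ cong (λ x → (x + m * k) % n) (+-offset α (proj₂ ri)) ⟩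
      (α % n + m * k) % n                ≡⟨ [m%n+o]%n≡[m+o]%n α (m * k) ⟩
      (α + m * k) % n                    ∎)
      where open ≡-Reasoning

    offset-α+m*k<⇔ : ∀ {m h} → m < d → offset i (α + m * k) < offset i α + h * k ⇔ m < h
    offset-α+m*k<⇔ {m} {h} m<d = mk⇔
      (λ lt → *-cancelʳ-< k m h (+-cancelˡ-< (offset i α) (m * k) (h * k)
                (subst (_< offset i α + h * k) (offset-α+m*k m<d) lt)))
      (λ m<h → subst (_< offset i α + h * k) (sym (offset-α+m*k m<d)) (+-monoʳ-< (offset i α) (*-monoˡ-< k m<h)))

    Excluded : ℕ → ℕ → Set
    Excluded h z = T (any (λ m → z ≡ᵇ iter m S-C α) (rangeFrom h d))

    Excluded⇒ : ∀ {h z} → Excluded h z → ∃ λ m → h ≤ m × m < d × z ≡ α + m * k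
    Excluded⇒ {h} {z} ex with find (any⁻ (λ m → z ≡ᵇ iter m S-C α) (rangeFrom h d) ex)
    ... | x , x∈ , z≡ with ∈-map⁻ (_+ h) x∈
    ... | j , j∈ , refl = j + h , m≤n+m h j , j+h<d , trans (≡ᵇ⇒≡ _ _ z≡) (S-C^ j+h<d)
      where
        j+h<d : j + h < d
        j+h<d = m<n∸o⇒m+o<n (∈-upTo⁻ j∈)

    α+m*k-excluded : ∀ {h m} → h ≤ m → m < d → Excluded h (α + m * k)
    α+m*k-excluded {h} {m} h≤m m<d = any⁺ _ (lose m∈ (≡⇒≡ᵇ _ _ (sym (S-C^ m<d))))
      where
        m∈ : m ∈ rangeFrom h d
        m∈ = subst (_∈ rangeFrom h d) (m∸n+n≡m h≤m) (∈-map⁺ (_+ h) (∈-upTo⁺ (∸-monoˡ-< m<d h≤m)))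

    Cut : ℕ → ℕ → Set
    Cut h z = T (C z) → offset i z < offset i α + h * k

    Psh⇒ : ∀ {h z} → T (Psh n k d a s h z) → T (Ps z) × Cut h z
    Psh⇒ {h} {z} t = proj₁ (Equivalence.to T-∧ t) , cut
      where
        ¬ex : ¬ Excluded h z
        ¬ex = Equivalence.to T-not⇔¬T (proj₂ (Equivalence.to T-∧ t))
        cut : Cut h z
        cut cz with C⇒α+m*k cz
        ... | m , m<d , z≡ with m <? h
        ...   | yes m<h = subst (λ w → offset i w < _) (sym z≡) (Equivalence.from (offset-α+m*k<⇔ m<d) m<h)
        ...   | no m≮h  = contradiction (subst (Excluded h) (sym z≡) (α+m*k-excluded (≮⇒≥ m≮h) m<d)) ¬ex

    ⇒Psh : ∀ {h z} → T (Ps z) → Cut h z → T (Psh n k d a s h z)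
    ⇒Psh {h} {z} pz cut = Equivalence.from T-∧ (pz , Equivalence.from T-not⇔¬T ¬ex)
      where
        ¬ex : ¬ Excluded h z
        ¬ex ex with Excluded⇒ {h} {z} ex
        ... | m , h≤m , m<d , z≡ =
          <⇒≱ (Equivalence.to (offset-α+m*k<⇔ m<d) (subst (Cut h) z≡ cut (α+m*k∈C m<d))) h≤m

    Before⇔Segment : ∀ {h L z} → Induced.Before (Psh n k d a s h) i L z ⇔ Segment Ps C i L (offset i α + h * k) z
    Before⇔Segment {h} {L} {z} = mk⇔
      (λ (rz , qz , z<L) → rz , proj₁ (Psh⇒ {h} {z} qz) , z<L , proj₂ (Psh⇒ {h} {z} qz))
      (λ (rz , pz , z<L , cut) → rz , ⇒Psh {h} {z} pz cut , z<L)

    Iset⇔Segment : ∀ {h} → 1 ≤ h →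
                   ∃ λ L → ∀ z → z ∈ Iset n k d a s i h ⇔ Segment Ps C i L (offset i α + h * k) z
    Iset⇔Segment {h@(suc h′)} _ =
      L , λ z → mk⇔ (Equivalence.to (Before⇔Segment {h} {L} {z}) ∘ Equivalence.to (mem z))
                    (Equivalence.from (mem z) ∘ Equivalence.from (Before⇔Segment {h} {L} {z}))
      where
        i∈Psh : T (Psh n k d a s h i)
        i∈Psh = ⇒Psh {h} pi λ _ → subst (_< offset i α + h * k) (sym (offset-self (proj₂ ri)))
                  (<-≤-trans (≤-trans (>-nonZero⁻¹ k) (m≤m+n k (h′ * k))) (m≤n+m (h * k) (offset i α)))
        orbit-segment : Induced.Orbit.OrbitIsSegment (Psh n k d a s h) ri i∈Psh k
        orbit-segment = Induced.Orbit.orbit-isSegment (Psh n k d a s h) ri i∈Psh k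
        L : ℕ
        L = proj₁ orbit-segment
        mem : ∀ z → z ∈ Iset n k d a s i h ⇔ Induced.Before (Psh n k d a s h) i L z
        mem = proj₁ (proj₂ orbit-segment)

  module Translation (x : ℤ) where

    e : ℕ
    e = (x ℤ.* + k) %ℕ n

    τ : ℕ → ℕ
    τ y = y ⊕[ n ] (x ℤ.* + k)

    τ-inRange : ∀ y → InRange (τ y)
    τ-inRange y = reduce-inRange n (+ y ℤ.+ x ℤ.* + k)

    τ-%n : ∀ y → τ y % n ≡ (y + e) % n
    τ-%n y = trans (reduce-% n (+ y ℤ.+ x ℤ.* + k)) ([+m+i]%ℕn≡[m+i%ℕn]%n y (x ℤ.* + k))

    τ-%k : ∀ y → τ y % k ≡ y % k
    τ-%k y = begin
      τ y % k           ≡⟨ m∣n⇒o%n%m≡o%m k n (τ y) k∣n ⟨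
      τ y % n % k       ≡⟨ cong (_% k) (τ-%n y) ⟩
      (y + e) % n % k   ≡⟨ m∣n⇒o%n%m≡o%m k n (y + e) k∣n ⟩
      (y + e) % k       ≡⟨ [m+o%n]%n≡[m+o]%n y e ⟨
      (y + e % k) % k   ≡⟨ cong (λ w → (y + w) % k) ([x*k]%ℕ[d*k]%k≡0 x d) ⟩
      (y + 0) % k       ≡⟨ cong (_% k) (+-identityʳ y) ⟩
      y % k             ∎
      where open ≡-Reasoning

    offset-τ : ∀ {t} y → InRange t → offset (τ t) (τ y) ≡ offset t y
    offset-τ {t} y rt = offset-unique (proj₂ (τ-inRange t)) (offset<n t y) (begin
      (τ t + offset t y) % n         ≡⟨ [m%n+o]%n≡[m+o]%n (τ t) (offset t y) ⟨
      (τ t % n + offset t y) % n     ≡⟨ cong (λ w → (w + offset t y) % n) (τ-%n t) ⟩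
      ((t + e) % n + offset t y) % n ≡⟨ [m%n+o]%n≡[m+o]%n (t + e) (offset t y) ⟩
      (t + e + offset t y) % n       ≡⟨ cong (_% n) (trans (+-assoc t e (offset t y))
                                          (trans (cong (_+_ t) (+-comm e (offset t y))) (sym (+-assoc t (offset t y) e)))) ⟩
      (t + offset t y + e) % n       ≡⟨ [m%n+o]%n≡[m+o]%n (t + offset t y) e ⟨
      ((t + offset t y) % n + e) % n ≡⟨ cong (λ w → (w + e) % n) (+-offset y (proj₂ rt)) ⟩
      (y % n + e) % n                ≡⟨ [m%n+o]%n≡[m+o]%n y e ⟩
      (y + e) % n                    ≡⟨ τ-%n y ⟨
      τ y % n                        ∎)
      where open ≡-Reasoning

    τ-surjective : ∀ {z} → InRange z → ∃ λ y → InRange y × τ y ≡ z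
    τ-surjective {z} rz = y , reduce-inRange n (+ (z + (n ∸ e))) ,
      %-injectiveOn-[1,n] (proj₁ (τ-inRange y)) (proj₂ (τ-inRange y)) (proj₁ rz) (proj₂ rz) (begin
        τ y % n                     ≡⟨ τ-%n y ⟩
        (y + e) % n                 ≡⟨ [m%n+o]%n≡[m+o]%n y e ⟨
        (y % n + e) % n             ≡⟨ cong (λ w → (w + e) % n) (reduce-% n (+ (z + (n ∸ e)))) ⟩
        ((z + (n ∸ e)) % n + e) % n ≡⟨ [m%n+o]%n≡[m+o]%n (z + (n ∸ e)) e ⟩
        (z + (n ∸ e) + e) % n       ≡⟨ cong (_% n) (trans (+-assoc z (n ∸ e) e)
                                          (cong (_+_ z) (m∸n+n≡m (<⇒≤ (n%ℕd<d (x ℤ.* + k) n))))) ⟩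
        (z + n) % n                 ≡⟨ [m+n]%n≡m%n z n ⟩
        z % n                       ∎)
      where
        open ≡-Reasoning
        y : ℕ
        y = reduce n (+ (z + (n ∸ e)))

    Segment-τ⁺ : ∀ {t L M y} → InRange t → Segment Ps C t L M y → Segment Ps C (τ t) L M (τ y)
    Segment-τ⁺ {t} {L} {M} {y} rt (ry , py , y<L , cut) =
      τ-inRange y ,
      subst T (Ps-resp ry (τ-inRange y) (sym (τ-%k y))) py ,
      subst (_< L) (sym (offset-τ y rt)) y<L ,
      λ cτy → subst (_< M) (sym (offset-τ y rt)) (cut (subst T (C-resp (τ-inRange y) ry (τ-%k y)) cτy))

    Segment-τ⁻ : ∀ {t L M y} → InRange t → InRange y → Segment Ps C (τ t) L M (τ y) → Segment Ps C t L M y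
    Segment-τ⁻ {t} {L} {M} {y} rt ry (_ , pτy , τy<L , cut) =
      ry ,
      subst T (Ps-resp (τ-inRange y) ry (τ-%k y)) pτy ,
      subst (_< L) (offset-τ y rt) τy<L ,
      λ cy → subst (_< M) (offset-τ y rt) (cut (subst T (C-resp ry (τ-inRange y) (sym (τ-%k y))) cy))

    shift⇔Segment : ∀ {I t L M} → InRange t → (∀ z → z ∈ I ⇔ Segment Ps C t L M z) →
                    ∀ z → z ∈ shift n I (x ℤ.* + k) ⇔ Segment Ps C (τ t) L M z
    shift⇔Segment {I} {t} {L} {M} rt I⇔ z = mk⇔ to from
      where
        to : ∀ {z} → z ∈ shift n I (x ℤ.* + k) → Segment Ps C (τ t) L M z
        to z∈ with ∈-map⁻ τ z∈
        ... | y , y∈ , refl = Segment-τ⁺ rt (Equivalence.to (I⇔ y) y∈)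
        from : ∀ {z} → Segment Ps C (τ t) L M z → z ∈ shift n I (x ℤ.* + k)
        from seg with τ-surjective (proj₁ seg)
        ... | y , ry , refl = ∈-map⁺ τ (Equivalence.from (I⇔ y) (Segment-τ⁻ rt ry seg))

  shifted-Iset⇔Segment : ∀ {i h} → InIdx n k a s i → 1 ≤ h → ∀ x →
    ∃ λ L → ∀ z → z ∈ shift n (Iset n k d a s i h) (x ℤ.* + k)
                    ⇔ Segment Ps C (Translation.τ x i) L (offset i α + h * k) z
  shifted-Iset⇔Segment i∈ 1≤h x =
    let (ri , pi , near) = InIdx⇒window i∈
        (L , Iset⇔) = Window.Iset⇔Segment ri pi near 1≤h
    in L , Translation.shift⇔Segment x ri Iset⇔

  shifted-Isets-noncrossing : ∀ {i h i′ h′} → InIdx n k a s i → 1 ≤ h → InIdx n k a s i′ → 1 ≤ h′ →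
    ∀ x x′ →
    Noncrossing (shift n (Iset n k d a s i h) (x ℤ.* + k)) (shift n (Iset n k d a s i′ h′) (x′ ℤ.* + k))
  shifted-Isets-noncrossing {i} {_} {i′} i∈ 1≤h i′∈ 1≤h′ x x′ =
    TwoSegments.noncrossing (proj₂ (Translation.τ-inRange x i)) (proj₂ (Translation.τ-inRange x′ i′))
      (proj₂ (shifted-Iset⇔Segment i∈ 1≤h x)) (proj₂ (shifted-Iset⇔Segment i′∈ 1≤h′ x′))

singleton-noncrossing : ∀ u J → Noncrossing (u ∷ []) J
singleton-noncrossing u J (a , b , c , d , cyc , (here refl , _) , (here refl , _) , _) = a≢c cyc refl
  where
    a≢c : ∀ {a b c d} → CyclicOrder a b c d → a ≢ c
    a≢c (inj₁ (ab , bc , _))               refl = <-asym ab bc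
    a≢c (inj₂ (inj₁ (_ , cd , da)))        refl = <-asym cd da
    a≢c (inj₂ (inj₂ (inj₁ (cd , da , _)))) refl = <-asym cd da
    a≢c (inj₂ (inj₂ (inj₂ (_ , ab , bc)))) refl = <-asym ab bc

proposition4p10 :
    (k d : ℕ) → 1 ≤ k → 1 ≤ d →
    (p c : ℤ) → (c ≡ ℤ.- (+ 1) ⊎ c ≡ + 0 ⊎ c ≡ + 1) →
    + k ≡ (+ d) ℤ.* p ℤ.+ c →
    (a : ℕ → ℕ) →
    (∀ i → 1 ≤ i → i ≤ k → 1 ≤ a i × a i ≤ k) →
    (∀ i j → 1 ≤ i → i ≤ k → 1 ≤ j → j ≤ k → a i ≡ a j → i ≡ j) →
    (∀ y → 1 ≤ y → y ≤ k → ∃ λ i → 1 ≤ i × i ≤ k × a i ≡ y) →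
    (s : ℕ) → 1 ≤ s → (+ s) ℤ.≤ (+ k) ℤ.- p ℤ.+ (+ 1) →
    (i h : ℕ) (x : ℤ) (i′ h′ : ℕ) (x′ : ℤ) →
    InIdx (d * k) k a s i → 1 ≤ h → h ≤ d →
    Unique (Iset (d * k) k d a s i h) →
    InIdx (d * k) k a s i′ → 1 ≤ h′ → h′ ≤ d →
    Unique (Iset (d * k) k d a s i′ h′) →
    Noncrossing (shift (d * k) (Iset (d * k) k d a s i h) (x ℤ.* (+ k)))
                (shift (d * k) (Iset (d * k) k d a s i′ h′) (x′ ℤ.* (+ k)))
proposition4p10 (suc zero) _ _ _ _ _ _ _ _ _ _ _ _ _ _ _ _ _ _ _ _ _ _ _ _ _ _ _ _ =
  singleton-noncrossing _ _
proposition4p10 k@(suc (suc k″)) (suc d′) _ _ p c c∈ k≡ a a-range a-injective _ s 1≤s s≤ _ _ x _ _ x′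
                i∈ 1≤h _ _ i′∈ 1≤h′ _ _ =
  Construction.shifted-Isets-noncrossing (suc k″) d′ a s 1≤s s≤k a-range a-injective i∈ 1≤h i′∈ 1≤h′ x x′
  where
    s≤k : s ≤ k
    s≤k = index-bound {d = suc d′} p c (s≤s (s≤s z≤n)) c∈ k≡ s≤
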